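{- Let $n\ge1$ and for each $1\le j\le n$ let $\mathbf r_j=(r_{j1},r_{j2},r_{j3})$ be an arithmetical $r$-structure on the cycle $C_3$, with $r_{j1}=r_0$ for all $j$. Let $\tilde{\mathbf r}=(r_0,r_{12},r_{13},r_{22},r_{23},\dots,r_{n2},r_{n3})$ be the resulting arithmetical $r$-structure on the fan graph $F_n$. Then $\tilde{\mathbf r}(1)>0$, i.e. at least one entry of $\tilde{\mathbf r}$ equals $1$.
   Context: The fan graph $F_n$ has vertices $v_0,\dots,v_{2n}$, with edges $v_0v_i$ for $1\le i\le 2n$ and $v_{2j-1}v_{2j}$ for $1\le j\le n$; $\tilde{\mathbf r}$ assigns $r_0$ to $v_0$, $r_{j2}$ to $v_{2j-1}$ and $r_{j3}$ to $v_{2j}$. For a graph $G$ with adjacency matrix $A$, an arithmetical $r$-structure is a primitive positive integer vector $\mathbf r$ indexed by vertices such that $(\mathrm{diag}(\mathbf d)-A)\mathbf r=0$ for some positive integer vector $\mathbf d$. For a vector $\mathbf r$, $\mathbf r(1)=\#\{i: r_i=1\}$. -}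

module Defs where

open import Data.Nat using (ℕ; zero; suc; _*_; _<_)
open import Data.Nat.Divisibility using (_∣_)
open import Data.Fin using (Fin; zero; suc; remQuot)
open import Data.Fin.Properties using () renaming (_≟_ to _≟ᶠ_)
open import Data.List using (List; tabulate; filter; length)
open import Data.Nat.ListAction using (sum)
open import Data.Product using (∃; _×_; _,_; proj₁; proj₂)
open import Data.Bool using (Bool; true; false; if_then_else_; _∧_; not)
open import Relation.Nullary.Decidable using (⌊_⌋)
open import Relation.Binary.PropositionalEquality using (_≡_)
import Data.Nat as ℕ

-- A graph on m vertices, given by its (symmetric, 0/1) adjacency matrix.
AdjMatrix : ℕ → Set
AdjMatrix m = Fin m → Fin m → ℕ

Σ : ∀ {m} → (Fin m → ℕ) → ℕ
Σ f = sum (tabulate f)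

Primitive : ∀ {m} → (Fin m → ℕ) → Set
Primitive {m} r = ∀ k → (∀ i → k ∣ r i) → k ≡ 1

IsArithmetical : ∀ {m} → AdjMatrix m → (Fin m → ℕ) → Set
IsArithmetical {m} A r =
  (∀ i → 0 < r i) × Primitive r ×
  ∃ λ (d : Fin m → ℕ) → (∀ i → 0 < d i) × (∀ i → d i * r i ≡ Σ (λ j → A i j * r j))

countOnes : ∀ {m} → (Fin m → ℕ) → ℕ
countOnes r = length (filter (λ x → x ℕ.≟ 1) (tabulate r))

C₃ : AdjMatrix 3
C₃ i j = if ⌊ i ≟ᶠ j ⌋ then 0 else 1

-- The fan graph F_n on vertices Fin (1 + n*2): index 0 is v₀, and index
-- suc k with remQuot 2 k = (j , t) is v_{2j+1+t} (0-based j), i.e.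
-- t = 0 gives v_{2j-1}, t = 1 gives v_{2j} in 1-based numbering.
Fan : ∀ n → AdjMatrix (suc (n * 2))
Fan n zero    zero    = 0
Fan n zero    (suc _) = 1
Fan n (suc _) zero    = 1
Fan n (suc a) (suc b) =
  let (j , t)   = remQuot {n} 2 a
      (j' , t') = remQuot {n} 2 b
  in if ⌊ j ≟ᶠ j' ⌋ ∧ not ⌊ t ≟ᶠ t' ⌋ then 1 else 0

-- The combined vector r̃ = (r₀, r₁₂, r₁₃, …, r_{n2}, r_{n3}) on F_n, from
-- r₀ and the family r j = (r_{j1}, r_{j2}, r_{j3}) (indices 0,1,2 of Fin 3).
rTilde : ∀ n → ℕ → (Fin n → Fin 3 → ℕ) → Fin (suc (n * 2)) → ℕ
rTilde n r₀ r zero    = r₀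
rTilde n r₀ r (suc a) with remQuot {n} 2 a
... | (j , zero)     = r j (suc zero)
... | (j , suc zero) = r j (suc (suc zero))

-- On the triangle C₃, let x be the least entry of an arithmetical structure, and y ≤ z the
-- other two. From c z = x + y ≤ 2z we get c ∈ {1, 2}: c = 2 forces x = y = z, and c = 1
-- gives z = x + y, so that b y = 2x + y, i.e. y divides 2x; as y ≥ x, y is x or 2x.
-- In every case x divides all entries, so primitivity gives x = 1. The structure r_1 on
-- the first triangle of the fan contributes r₀, r₁₂, r₁₃ to r̃, so one of these is 1.
module Submission where

open import Defs
open import Data.Nat using (ℕ; zero; suc; _+_; _*_; _≤_; _<_; _≥_; s≤s; _≟_)
open import Data.Nat.Properties
open import Data.Nat.Divisibility using (_∣_; ∣-refl; ∣-reflexive; ∣m∣n⇒∣m+n)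
open import Data.Fin using (Fin; zero; suc)
open import Data.List.Properties using (filter-some)
open import Data.List.Relation.Unary.Any.Properties using (tabulate⁺)
open import Data.Product using (_×_; _,_)
open import Data.Sum using (_⊎_; inj₁; inj₂)
open import Relation.Binary.PropositionalEquality using (_≡_; sym; trans; cong; cong₂; subst; module ≡-Reasoning)

z+z≤x+y⇒x≡z : ∀ {x y z} → x ≤ z → y ≤ z → z + z ≤ x + y → x ≡ z
z+z≤x+y⇒x≡z {x} {z = z} x≤z y≤z z+z≤x+y =
  ≤-antisym x≤z (+-cancelʳ-≤ z z x (≤-trans z+z≤x+y (+-monoʳ-≤ x y≤z)))

k*y≡x+x⇒x∣y : ∀ {x y} k → 0 < x → x ≤ y → k * y ≡ x + x → x ∣ y
k*y≡x+x⇒x∣y zero          (s≤s _) _   ()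
k*y≡x+x⇒x∣y {x} (suc zero) _      _   y+0≡x+x =
  subst (x ∣_) (sym (trans (sym (+-identityʳ _)) y+0≡x+x)) (∣m∣n⇒∣m+n ∣-refl ∣-refl)
k*y≡x+x⇒x∣y {x} {y} (suc (suc k)) _ x≤y eq =
  ∣-reflexive (z+z≤x+y⇒x≡z x≤y x≤y (≤-trans (+-monoʳ-≤ y (m≤m+n y (k * y))) (≤-reflexive eq)))

least-divides-sorted : ∀ {x y z} b c → 0 < x → x ≤ y → y ≤ z →
  b * y ≡ x + z → c * z ≡ x + y → x ∣ y × x ∣ z
least-divides-sorted b zero (s≤s _) _ _ _ ()
least-divides-sorted zero (suc zero) (s≤s _) _ _ () _
least-divides-sorted {x} {y} {z} (suc b) (suc zero) 0<x x≤y _ b*y≡x+z z+0≡x+y =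
  x∣y , subst (x ∣_) (sym z≡x+y) (∣m∣n⇒∣m+n ∣-refl x∣y)
  where
  z≡x+y : z ≡ x + y
  z≡x+y = trans (sym (+-identityʳ z)) z+0≡x+y
  b*y≡x+x : b * y ≡ x + x
  b*y≡x+x = +-cancelˡ-≡ y _ _ (begin
    y + b * y        ≡⟨ b*y≡x+z ⟩
    x + z            ≡⟨ cong (x +_) z≡x+y ⟩
    x + (x + y)      ≡⟨ sym (+-assoc x x y) ⟩
    x + x + y        ≡⟨ +-comm (x + x) y ⟩
    y + (x + x)      ∎)
    where open ≡-Reasoning
  x∣y : x ∣ y
  x∣y = k*y≡x+x⇒x∣y b 0<x x≤y b*y≡x+x
least-divides-sorted {x} {y} {z} b (suc (suc c)) _ x≤y y≤z _ eq =
  ∣-reflexive (trans x≡z (sym y≡z)) , ∣-reflexive x≡z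
  where
  z+z≤x+y : z + z ≤ x + y
  z+z≤x+y = ≤-trans (+-monoʳ-≤ z (m≤m+n z (c * z))) (≤-reflexive eq)
  x≡z : x ≡ z
  x≡z = z+z≤x+y⇒x≡z (≤-trans x≤y y≤z) y≤z z+z≤x+y
  y≡z : y ≡ z
  y≡z = z+z≤x+y⇒x≡z y≤z (≤-trans x≤y y≤z) (subst (z + z ≤_) (+-comm x y) z+z≤x+y)

least-divides : ∀ {x y z} b c → 0 < x → x ≤ y → x ≤ z →
  b * y ≡ x + z → c * z ≡ x + y → x ∣ y × x ∣ z
least-divides {y = y} {z} b c 0<x x≤y x≤z eb ec with ≤-total y z
... | inj₁ y≤z = least-divides-sorted b c 0<x x≤y y≤z eb ec
... | inj₂ z≤y with least-divides-sorted c b 0<x x≤z z≤y ec eb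
...   | x∣z , x∣y = x∣y , x∣z

minimum-of-three : ∀ a b c → (a ≤ b × a ≤ c) ⊎ (b ≤ a × b ≤ c) ⊎ (c ≤ a × c ≤ b)
minimum-of-three a b c with ≤-total a b | ≤-total a c | ≤-total b c
... | inj₁ a≤b | inj₁ a≤c | _        = inj₁ (a≤b , a≤c)
... | inj₁ a≤b | inj₂ c≤a | _        = inj₂ (inj₂ (c≤a , ≤-trans c≤a a≤b))
... | inj₂ b≤a | _        | inj₁ b≤c = inj₂ (inj₁ (b≤a , b≤c))
... | inj₂ b≤a | _        | inj₂ c≤b = inj₂ (inj₂ (≤-trans c≤b b≤a , c≤b))

pattern 0F = zero
pattern 1F = suc zero
pattern 2F = suc (suc zero)

-- The normal form of Σ (λ j → C₃ i j * r j): 1 * x unfolds to x + 0, the diagonal term to 0.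
C₃-row-sum : ∀ x y → (x + 0) + ((y + 0) + 0) ≡ x + y
C₃-row-sum x y = cong₂ _+_ (+-identityʳ x) (trans (+-identityʳ (y + 0)) (+-identityʳ y))

C₃-balance : ∀ (d r : Fin 3 → ℕ) → (∀ i → d i * r i ≡ Σ (λ j → C₃ i j * r j)) →
  d 0F * r 0F ≡ r 1F + r 2F × d 1F * r 1F ≡ r 0F + r 2F × d 2F * r 2F ≡ r 0F + r 1F
C₃-balance d r balanced =
    trans (balanced 0F) (C₃-row-sum (r 1F) (r 2F))
  , trans (balanced 1F) (C₃-row-sum (r 0F) (r 2F))
  , trans (balanced 2F) (C₃-row-sum (r 0F) (r 1F))

divides-all₃ : ∀ {k} (r : Fin 3 → ℕ) → k ∣ r 0F → k ∣ r 1F → k ∣ r 2F → ∀ i → k ∣ r i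
divides-all₃ r k∣r₀ k∣r₁ k∣r₂ 0F = k∣r₀
divides-all₃ r k∣r₀ k∣r₁ k∣r₂ 1F = k∣r₁
divides-all₃ r k∣r₀ k∣r₁ k∣r₂ 2F = k∣r₂

C₃-arithmetical-has-one : ∀ r → IsArithmetical C₃ r → r 0F ≡ 1 ⊎ r 1F ≡ 1 ⊎ r 2F ≡ 1
C₃-arithmetical-has-one r (pos , prim , d , _ , balanced)
  with C₃-balance d r balanced | minimum-of-three (r 0F) (r 1F) (r 2F)
... | e₀ , e₁ , e₂ | inj₁ (r₀≤r₁ , r₀≤r₂) =
  let r₀∣r₁ , r₀∣r₂ = least-divides (d 1F) (d 2F) (pos 0F) r₀≤r₁ r₀≤r₂ e₁ e₂
  in inj₁ (prim _ (divides-all₃ r ∣-refl r₀∣r₁ r₀∣r₂))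
... | e₀ , e₁ , e₂ | inj₂ (inj₁ (r₁≤r₀ , r₁≤r₂)) =
  let r₁∣r₀ , r₁∣r₂ = least-divides (d 0F) (d 2F) (pos 1F) r₁≤r₀ r₁≤r₂
                        e₀ (trans e₂ (+-comm (r 0F) (r 1F)))
  in inj₂ (inj₁ (prim _ (divides-all₃ r r₁∣r₀ ∣-refl r₁∣r₂)))
... | e₀ , e₁ , e₂ | inj₂ (inj₂ (r₂≤r₀ , r₂≤r₁)) =
  let r₂∣r₀ , r₂∣r₁ = least-divides (d 0F) (d 1F) (pos 2F) r₂≤r₀ r₂≤r₁
                        (trans e₀ (+-comm (r 1F) (r 2F))) (trans e₁ (+-comm (r 0F) (r 2F)))
  in inj₂ (inj₂ (prim _ (divides-all₃ r r₂∣r₀ r₂∣r₁ ∣-refl)))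

countOnes-pos : ∀ {m} (v : Fin m → ℕ) i → v i ≡ 1 → 0 < countOnes v
countOnes-pos v i vi≡1 = filter-some (_≟ 1) (tabulate⁺ i vi≡1)

mainTheorem9 : (n : ℕ) → n ≥ 1 → (r₀ : ℕ) → (r : Fin n → Fin 3 → ℕ) →
    (∀ j → IsArithmetical C₃ (r j)) → (∀ j → r j zero ≡ r₀) →
    0 < countOnes (rTilde n r₀ r)
mainTheorem9 (suc n) _ r₀ r arithmetical r-0≡r₀
  with C₃-arithmetical-has-one (r 0F) (arithmetical 0F)
... | inj₁ r₀≡1        = countOnes-pos (rTilde (suc n) r₀ r) 0F (trans (sym (r-0≡r₀ 0F)) r₀≡1)
... | inj₂ (inj₁ r₁₂≡1) = countOnes-pos (rTilde (suc n) r₀ r) 1F r₁₂≡1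
... | inj₂ (inj₂ r₁₃≡1) = countOnes-pos (rTilde (suc n) r₀ r) 2F r₁₃≡1
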